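{- Let $Q$ and $Q'$ be proper quadrilaterals in $\mathbb{k}^2$ ($\mathbb{k}$ a field of characteristic $\neq2$) with the same set of vertices. Then two lines are $Q$-orthogonal if and only if they are $Q'$-orthogonal.
   Context: Every line $L$ has an equation $tX-uY+v=0$ normalized so that $t=1$ if $u=0$ and $u=1$ if $u\ne0$; write $t_L,u_L,v_L$. A quadrilateral $Q=ABA'B'$: four distinct lines, not all concurrent, adjacent sides ($\{A,B\},\{B,A'\},\{A',B'\},\{B',A\}$) not parallel; vertices $A\cap B,B\cap A',A'\cap B',B'\cap A$; proper means these four vertices are distinct. $\alpha = t_Au_Bu_{A'}u_{B'} - u_At_Bu_{A'}u_{B'} + u_Au_Bt_{A'}u_{B'} - u_Au_Bu_{A'}t_{B'}$, $\beta = t_Au_Bt_{A'}u_{B'}-u_At_Bu_{A'}t_{B'}$, $\gamma = t_At_Bt_{A'}u_{B'}-t_At_Bu_{A'}t_{B'}+t_Au_Bt_{A'}t_{B'}-u_At_Bt_{A'}t_{B'}$; $\langle \mathbf v,\mathbf w\rangle_Q=\mathbf v^T\begin{pmatrix}\gamma&-\beta\\-\beta&\alpha\end{pmatrix}\mathbf w$. Lines $\ell_1,\ell_2$ are $Q$-orthogonal if $\langle (u_{\ell_1},t_{\ell_1}),(u_{\ell_2},t_{\ell_2})\rangle_Q=0$. -}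

module Defs where

open import Level using (Level; _⊔_; suc)
open import Algebra.Bundles using (CommutativeRing)
open import Data.Product using (Σ; ∃; _×_; _,_)
open import Data.Sum using (_⊎_)
open import Relation.Nullary using (¬_)

record Field (c ℓ : Level) : Set (suc (c ⊔ ℓ)) where
  field
    commutativeRing : CommutativeRing c ℓ
  open CommutativeRing commutativeRing public
  field
    0≉1     : ¬ (0# ≈ 1#)
    inverse : ∀ x → ¬ (x ≈ 0#) → ∃ λ y → x * y ≈ 1#

CharNot2 : ∀ {c ℓ} → Field c ℓ → Set ℓ
CharNot2 k = ¬ (1# + 1# ≈ 0#)
  where open Field k

module Geometry {c ℓ} (k : Field c ℓ) where
  open Field k

  -- A line  t X - u Y + v = 0, stored by its normalized coefficients:
  -- t = 1 if u = 0, and u = 1 if u ≠ 0.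
  record Line : Set (c ⊔ ℓ) where
    constructor line
    field
      t u v : Carrier
      normalized : (u ≈ 0# × t ≈ 1#) ⊎ (u ≈ 1#)
  open Line public

  _≈L_ : Line → Line → Set ℓ
  L ≈L M = (t L ≈ t M) × (u L ≈ u M) × (v L ≈ v M)

  Point : Set c
  Point = Carrier × Carrier

  _≈P_ : Point → Point → Set ℓ
  (x , y) ≈P (x' , y') = (x ≈ x') × (y ≈ y')

  _∈L_ : Point → Line → Set ℓ
  (x , y) ∈L L = (t L * x - u L * y + v L) ≈ 0#

  Parallel : Line → Line → Set ℓ
  Parallel L M = t L * u M ≈ u L * t M

  IsMeet : Point → Line → Line → Set ℓ
  IsMeet P L M = (P ∈L L) × (P ∈L M)

  record Quadrilateral : Set (c ⊔ ℓ) where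
    constructor quad
    field
      A B A' B' : Line
  open Quadrilateral public

  IsQuadrilateral : Quadrilateral → Set (c ⊔ ℓ)
  IsQuadrilateral (quad A B A' B') =
    ¬ (A ≈L B) × ¬ (A ≈L A') × ¬ (A ≈L B') × ¬ (B ≈L A') × ¬ (B ≈L B') × ¬ (A' ≈L B')
    × ¬ (Σ Point λ P → (P ∈L A) × (P ∈L B) × (P ∈L A') × (P ∈L B'))
    × ¬ Parallel A B × ¬ Parallel B A' × ¬ Parallel A' B' × ¬ Parallel B' A

  V₁ V₂ V₃ V₄ : Quadrilateral → Point → Set ℓ
  V₁ Q P = IsMeet P (A Q) (B Q)
  V₂ Q P = IsMeet P (B Q) (A' Q)
  V₃ Q P = IsMeet P (A' Q) (B' Q)
  V₄ Q P = IsMeet P (B' Q) (A Q)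

  IsVertex : Quadrilateral → Point → Set ℓ
  IsVertex Q P = V₁ Q P ⊎ V₂ Q P ⊎ V₃ Q P ⊎ V₄ Q P

  -- proper: the four vertices are pairwise distinct
  -- (no point is simultaneously two different vertices; each vertex is
  --  a unique point since adjacent sides are not parallel)
  IsProper : Quadrilateral → Set (c ⊔ ℓ)
  IsProper Q =
    IsQuadrilateral Q ×
    (∀ P → ¬ (V₁ Q P × V₂ Q P)) × (∀ P → ¬ (V₁ Q P × V₃ Q P)) ×
    (∀ P → ¬ (V₁ Q P × V₄ Q P)) × (∀ P → ¬ (V₂ Q P × V₃ Q P)) ×
    (∀ P → ¬ (V₂ Q P × V₄ Q P)) × (∀ P → ¬ (V₃ Q P × V₄ Q P))

  SameVertices : Quadrilateral → Quadrilateral → Set (c ⊔ ℓ)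
  SameVertices Q Q' =
    (∀ P → IsVertex Q P → Σ Point λ P' → (P ≈P P') × IsVertex Q' P') ×
    (∀ P → IsVertex Q' P → Σ Point λ P' → (P ≈P P') × IsVertex Q P')

  α β γ : Quadrilateral → Carrier
  α (quad A B A' B') =
    t A * u B * u A' * u B' - u A * t B * u A' * u B'
    + u A * u B * t A' * u B' - u A * u B * u A' * t B'
  β (quad A B A' B') =
    t A * u B * t A' * u B' - u A * t B * u A' * t B'
  γ (quad A B A' B') =
    t A * t B * t A' * u B' - t A * t B * u A' * t B'
    + t A * u B * t A' * t B' - u A * t B * t A' * t B'

  ⟨_,_⟩[_] : Point → Point → Quadrilateral → Carrier
  ⟨ (v₁ , v₂) , (w₁ , w₂) ⟩[ Q ] =
    v₁ * (γ Q * w₁ - β Q * w₂) + v₂ * (- (β Q) * w₁ + α Q * w₂)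

  Orthogonal : Quadrilateral → Line → Line → Set ℓ
  Orthogonal Q ℓ₁ ℓ₂ = ⟨ (u ℓ₁ , t ℓ₁) , (u ℓ₂ , t ℓ₂) ⟩[ Q ] ≈ 0#

{-# OPTIONS --safe #-}
module Submission where

-- Write v ⊙ w for the symmetric product of two direction vectors and a, a', b, b' for the
-- directions of the sides A, A', B, B'. Expanding the definitions gives
-- ⟨v,w⟩_Q = − det (v ⊙ w, a ⊙ a', b ⊙ b'), so the form depends on Q only through the pencil
-- spanned by its two pairs of opposite sides. As no three vertices of a proper quadrilateral
-- are collinear, two lines covering its four vertices are a pair of opposite sides or the two
-- diagonals, and in each case their ⊙ lies in that pencil (for the diagonals because
-- (p₃ − p₁) ⊙ (p₄ − p₂) = (p₄ − p₁) ⊙ (p₃ − p₂) + (p₂ − p₁) ⊙ (p₄ − p₃)). Hence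
-- ⟨,⟩_Q' = μ ⟨,⟩_Q, μ being the determinant of the change of basis, and symmetrically.

open import Defs
open import Data.Product using (_×_; _,_; proj₁; proj₂; ∃; Σ)
open import Level using (_⊔_)
open import Relation.Nullary using (¬_)
open import Data.Sum using (_⊎_; inj₁; inj₂)
open import Data.Empty using (⊥; ⊥-elim)
open import Algebra.Bundles using (CommutativeRing)
open import Data.Maybe.Base using (Maybe; map)
open import Data.Nat.Base as ℕ using (zero; suc)
import Data.Nat.Properties as ℕ
open import Data.Integer.Base as ℤ using (ℤ; +_; -[1+_]; +0; +[1+_]; +-*-rawRing)
import Data.Integer.Properties as ℤ
open import Data.Sign.Base as Sign using (Sign)
open import Relation.Binary.Consequences using (dec⇒weaklyDec)
import Relation.Binary.PropositionalEquality as ≡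

-- The ring solver needs coefficients with decidable equality; ℤ maps into every commutative ring.
module IntegerCoefficients {c ℓ} (R : CommutativeRing c ℓ) where
  open CommutativeRing R
  open import Algebra.Properties.Ring ring
  open import Algebra.Properties.Semiring.Mult semiring using (×-homo-+; ×1-homo-*) renaming (_×_ to _·_)
  open import Relation.Binary.Reasoning.Setoid setoid
  open import Algebra.Solver.Ring.AlmostCommutativeRing
    using (fromCommutativeRing; _-Raw-AlmostCommutative⟶_)

  signed : Sign → Carrier → Carrier
  signed Sign.+ x = x
  signed Sign.- x = - x

  ⟦_⟧ℤ : ℤ → Carrier
  ⟦ + n ⟧ℤ = n · 1#
  ⟦ -[1+ n ] ⟧ℤ = - (suc n · 1#)

  ⟦◃⟧ : ∀ s n → ⟦ s ℤ.◃ n ⟧ℤ ≈ signed s (n · 1#)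
  ⟦◃⟧ Sign.+ zero = refl
  ⟦◃⟧ Sign.- zero = sym -0#≈0#
  ⟦◃⟧ Sign.+ (suc n) = refl
  ⟦◃⟧ Sign.- (suc n) = refl

  ⟦⟧ℤ-signAbs : ∀ i → ⟦ i ⟧ℤ ≈ signed (ℤ.sign i) (ℤ.∣ i ∣ · 1#)
  ⟦⟧ℤ-signAbs +0 = refl
  ⟦⟧ℤ-signAbs +[1+ n ] = refl
  ⟦⟧ℤ-signAbs -[1+ n ] = refl

  signed-cong : ∀ s {x y} → x ≈ y → signed s x ≈ signed s y
  signed-cong Sign.+ x≈y = x≈y
  signed-cong Sign.- x≈y = -‿cong x≈y

  signed-* : ∀ s t x y → signed (s Sign.* t) (x * y) ≈ signed s x * signed t y
  signed-* Sign.+ Sign.+ x y = refl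
  signed-* Sign.+ Sign.- x y = -‿distribʳ-* x y
  signed-* Sign.- Sign.+ x y = -‿distribˡ-* x y
  signed-* Sign.- Sign.- x y = begin
    x * y         ≈⟨ -‿involutive (x * y) ⟨
    - - (x * y)   ≈⟨ -‿cong (-‿distribʳ-* x y) ⟩
    - (x * - y)   ≈⟨ -‿distribˡ-* x (- y) ⟩
    - x * - y     ∎

  1+x-[1+y]≈x-y : ∀ x y → (1# + x) - (1# + y) ≈ x - y
  1+x-[1+y]≈x-y x y = begin
    (1# + x) - (1# + y)     ≈⟨ +-congˡ (-‿+-comm 1# y) ⟨
    (1# + x) + (- 1# - y)   ≈⟨ +-congʳ (+-comm 1# x) ⟩
    (x + 1#) + (- 1# - y)   ≈⟨ +-assoc x 1# (- 1# - y) ⟩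
    x + (1# + (- 1# - y))   ≈⟨ +-congˡ (+-assoc 1# (- 1#) (- y)) ⟨
    x + ((1# - 1#) - y)     ≈⟨ +-congˡ (+-congʳ (-‿inverseʳ 1#)) ⟩
    x + (0# - y)            ≈⟨ +-congˡ (+-identityˡ (- y)) ⟩
    x - y                   ∎

  ⟦⊖⟧ : ∀ m n → ⟦ m ℤ.⊖ n ⟧ℤ ≈ m · 1# - n · 1#
  ⟦⊖⟧ m zero = sym (trans (+-congˡ -0#≈0#) (+-identityʳ _))
  ⟦⊖⟧ zero (suc n) = sym (+-identityˡ _)
  ⟦⊖⟧ (suc m) (suc n) = begin
    ⟦ suc m ℤ.⊖ suc n ⟧ℤ  ≡⟨ ≡.cong ⟦_⟧ℤ (ℤ.[1+m]⊖[1+n]≡m⊖n m n) ⟩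
    ⟦ m ℤ.⊖ n ⟧ℤ          ≈⟨ ⟦⊖⟧ m n ⟩
    m · 1# - n · 1#       ≈⟨ 1+x-[1+y]≈x-y (m · 1#) (n · 1#) ⟨
    suc m · 1# - suc n · 1# ∎

  ⟦⟧ℤ-homo-+ : ∀ i j → ⟦ i ℤ.+ j ⟧ℤ ≈ ⟦ i ⟧ℤ + ⟦ j ⟧ℤ
  ⟦⟧ℤ-homo-+ (+ m) (+ n) = ×-homo-+ 1# m n
  ⟦⟧ℤ-homo-+ (+ m) -[1+ n ] = ⟦⊖⟧ m (suc n)
  ⟦⟧ℤ-homo-+ -[1+ m ] (+ n) = trans (⟦⊖⟧ n (suc m)) (+-comm _ _)
  ⟦⟧ℤ-homo-+ -[1+ m ] -[1+ n ] = begin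
    - (suc (suc (m ℕ.+ n)) · 1#)  ≡⟨ ≡.cong (λ k → - (suc k · 1#)) (ℕ.+-suc m n) ⟨
    - ((suc m ℕ.+ suc n) · 1#)    ≈⟨ -‿cong (×-homo-+ 1# (suc m) (suc n)) ⟩
    - (suc m · 1# + suc n · 1#)   ≈⟨ -‿+-comm (suc m · 1#) (suc n · 1#) ⟨
    - (suc m · 1#) - suc n · 1#   ∎

  ⟦⟧ℤ-homo-* : ∀ i j → ⟦ i ℤ.* j ⟧ℤ ≈ ⟦ i ⟧ℤ * ⟦ j ⟧ℤ
  ⟦⟧ℤ-homo-* i j = begin
    ⟦ s ℤ.◃ ∣i∣ ℕ.* ∣j∣ ⟧ℤ                   ≈⟨ ⟦◃⟧ s (∣i∣ ℕ.* ∣j∣) ⟩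
    signed s ((∣i∣ ℕ.* ∣j∣) · 1#)            ≈⟨ signed-cong s (×1-homo-* ∣i∣ ∣j∣) ⟩
    signed s (∣i∣ · 1# * ∣j∣ · 1#)           ≈⟨ signed-* (ℤ.sign i) (ℤ.sign j) _ _ ⟩
    signed (ℤ.sign i) (∣i∣ · 1#) * signed (ℤ.sign j) (∣j∣ · 1#)
                                             ≈⟨ *-cong (⟦⟧ℤ-signAbs i) (⟦⟧ℤ-signAbs j) ⟨
    ⟦ i ⟧ℤ * ⟦ j ⟧ℤ                          ∎
    where
    s = ℤ.sign i Sign.* ℤ.sign j
    ∣i∣ = ℤ.∣ i ∣
    ∣j∣ = ℤ.∣ j ∣

  ⟦⟧ℤ-homo-neg : ∀ i → ⟦ ℤ.- i ⟧ℤ ≈ - ⟦ i ⟧ℤ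
  ⟦⟧ℤ-homo-neg -[1+ n ] = sym (-‿involutive _)
  ⟦⟧ℤ-homo-neg +0 = sym -0#≈0#
  ⟦⟧ℤ-homo-neg +[1+ n ] = refl

  ℤ⟶R : +-*-rawRing -Raw-AlmostCommutative⟶ fromCommutativeRing R
  ℤ⟶R = record
    { ⟦_⟧ = ⟦_⟧ℤ
    ; +-homo = ⟦⟧ℤ-homo-+
    ; *-homo = ⟦⟧ℤ-homo-*
    ; -‿homo = ⟦⟧ℤ-homo-neg
    ; 0-homo = refl
    ; 1-homo = +-identityʳ 1#
    }

  ⟦⟧ℤ-weaklyDec : ∀ i j → Maybe (⟦ i ⟧ℤ ≈ ⟦ j ⟧ℤ)
  ⟦⟧ℤ-weaklyDec i j = map (λ { ≡.refl → refl }) (dec⇒weaklyDec ℤ._≟_ i j)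

  open import Algebra.Solver.Ring +-*-rawRing (fromCommutativeRing R) ℤ⟶R ⟦⟧ℤ-weaklyDec public

module Plane {c ℓ} (k : Field c ℓ) where
  open Field k
  open Geometry k
  open IntegerCoefficients commutativeRing using (solve; _:=_; _:+_; _:-_; _:*_; :-_)
  open import Algebra.Properties.Group +-group using (x∙y⁻¹≈ε⇒x≈y)
  open import Algebra.Properties.Ring ring using (-‿distribʳ-*)
  open import Relation.Binary.Reasoning.Setoid setoid

  Unit : Carrier → Set (c ⊔ ℓ)
  Unit s = ∃ λ r → r * s ≈ 1#

  inverse-unit : ∀ x (x≉0 : ¬ x ≈ 0#) → Unit (proj₁ (inverse x x≉0))
  inverse-unit x x≉0 = x , proj₂ (inverse x x≉0)

  Unit-* : ∀ {s s'} → Unit s → Unit s' → Unit (s * s')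
  Unit-* {s} {s'} (r , rs≈1) (r' , r's'≈1) = r * r' , (begin
    (r * r') * (s * s') ≈⟨ solve 4 (λ r r' s s' → (r :* r') :* (s :* s') := (r :* s) :* (r' :* s')) refl r r' s s' ⟩
    (r * s) * (r' * s') ≈⟨ *-cong rs≈1 r's'≈1 ⟩
    1# * 1#             ≈⟨ *-identityˡ 1# ⟩
    1#                  ∎)

  unit-cancel : ∀ {s x} → Unit s → s * x ≈ 0# → x ≈ 0#
  unit-cancel {s} {x} (r , rs≈1) sx≈0 = begin
    x            ≈⟨ *-identityˡ x ⟨
    1# * x       ≈⟨ *-congʳ rs≈1 ⟨
    (r * s) * x  ≈⟨ *-assoc r s x ⟩
    r * (s * x)  ≈⟨ *-congˡ sx≈0 ⟩
    r * 0#       ≈⟨ zeroʳ r ⟩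
    0#           ∎

  unit-rescale : ∀ {r s x y} a → r * s ≈ 1# → y ≈ s * x → a * x ≈ (a * r) * y
  unit-rescale {r} {s} {x} {y} a rs≈1 y≈sx = begin
    a * x              ≈⟨ *-congˡ (*-identityˡ x) ⟨
    a * (1# * x)       ≈⟨ *-congˡ (*-congʳ rs≈1) ⟨
    a * ((r * s) * x)  ≈⟨ solve 4 (λ a r s x → a :* ((r :* s) :* x) := (a :* r) :* (s :* x)) refl a r s x ⟩
    (a * r) * (s * x)  ≈⟨ *-congˡ y≈sx ⟨
    (a * r) * y        ∎

  x-y≈0⇒x≈y : ∀ {x y} → x - y ≈ 0# → x ≈ y
  x-y≈0⇒x≈y {x} {y} = x∙y⁻¹≈ε⇒x≈y x y

  infixl 6 _-ᴾ_
  infixr 7 _·ᴾ_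
  infix 4 _∼ᴾ_

  _-ᴾ_ : Point → Point → Point
  (x , y) -ᴾ (x' , y') = x - x' , y - y'

  _·ᴾ_ : Carrier → Point → Point
  s ·ᴾ (x , y) = s * x , s * y

  _∼ᴾ_ : Point → Point → Set (c ⊔ ℓ)
  v ∼ᴾ w = ∃ λ s → Unit s × v ≈P (s ·ᴾ w)

  dir : Line → Point
  dir L = u L , t L

  cross : Point → Point → Carrier
  cross (x₁ , x₂) (y₁ , y₂) = x₂ * y₁ - x₁ * y₂

  cross-cong : ∀ {v v' w} → v ≈P v' → cross v w ≈ cross v' w
  cross-cong (e₁ , e₂) = +-cong (*-congʳ e₂) (-‿cong (*-congʳ e₁))

  cross-scaleˡ : ∀ s v w → cross (s ·ᴾ v) w ≈ s * cross v w
  cross-scaleˡ s (x₁ , x₂) (y₁ , y₂) =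
    solve 5 (λ s x₁ x₂ y₁ y₂ → (s :* x₂) :* y₁ :- (s :* x₁) :* y₂ := s :* (x₂ :* y₁ :- x₁ :* y₂))
      refl s x₁ x₂ y₁ y₂

  ∼ᴾ-cross≈0 : ∀ {v w} x → v ∼ᴾ w → cross v x ≈ 0# → cross w x ≈ 0#
  ∼ᴾ-cross≈0 {w = w} x (s , unit , v≈sw) vx≈0 =
    unit-cancel unit (trans (sym (cross-scaleˡ s w x)) (trans (sym (cross-cong v≈sw)) vx≈0))

  ∼ᴾ-cross≈0⁻¹ : ∀ {v w} x → v ∼ᴾ w → cross w x ≈ 0# → cross v x ≈ 0#
  ∼ᴾ-cross≈0⁻¹ {v} {w} x (s , _ , v≈sw) wx≈0 = begin
    cross v x         ≈⟨ cross-cong v≈sw ⟩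
    cross (s ·ᴾ w) x  ≈⟨ cross-scaleˡ s w x ⟩
    s * cross w x     ≈⟨ *-congˡ wx≈0 ⟩
    s * 0#            ≈⟨ zeroʳ s ⟩
    0#                ∎

  eval : Line → Point → Carrier
  eval L (x , y) = t L * x - u L * y + v L

  eval-chord : ∀ L p q → eval L q ≈ eval L p + cross (dir L) (q -ᴾ p)
  eval-chord L (p₁ , p₂) (q₁ , q₂) =
    solve 7 (λ t u v p₁ p₂ q₁ q₂ →
        t :* q₁ :- u :* q₂ :+ v := (t :* p₁ :- u :* p₂ :+ v) :+ (t :* (q₁ :- p₁) :- u :* (q₂ :- p₂)))
      refl (t L) (u L) (v L) p₁ p₂ q₁ q₂

  ∈L⇒cross≈0 : ∀ L {p q} → p ∈L L → q ∈L L → cross (dir L) (q -ᴾ p) ≈ 0#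
  ∈L⇒cross≈0 L {p} {q} p∈L q∈L = begin
    cross (dir L) (q -ᴾ p)              ≈⟨ +-identityˡ _ ⟨
    0# + cross (dir L) (q -ᴾ p)         ≈⟨ +-congʳ p∈L ⟨
    eval L p + cross (dir L) (q -ᴾ p)   ≈⟨ eval-chord L p q ⟨
    eval L q                            ≈⟨ q∈L ⟩
    0#                                  ∎

  cross≈0⇒∈L : ∀ L {p q} → p ∈L L → cross (dir L) (q -ᴾ p) ≈ 0# → q ∈L L
  cross≈0⇒∈L L {p} {q} p∈L cross≈0 = begin
    eval L q                            ≈⟨ eval-chord L p q ⟩
    eval L p + cross (dir L) (q -ᴾ p)   ≈⟨ +-cong p∈L cross≈0 ⟩
    0# + 0#                             ≈⟨ +-identityˡ 0# ⟩
    0#                                  ∎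

  ∈L-resp-≈P : ∀ L {p q} → p ≈P q → q ∈L L → p ∈L L
  ∈L-resp-≈P L (e₁ , e₂) = trans (+-congʳ (+-cong (*-congˡ e₁) (-‿cong (*-congˡ e₂))))

  IsMeet-resp-≈P : ∀ L M {p q} → p ≈P q → IsMeet q L M → IsMeet p L M
  IsMeet-resp-≈P L M p≈q (q∈L , q∈M) = ∈L-resp-≈P L p≈q q∈L , ∈L-resp-≈P M p≈q q∈M

  chord≈0⇒≈P : ∀ {p q} → proj₁ (q -ᴾ p) ≈ 0# → proj₂ (q -ᴾ p) ≈ 0# → p ≈P q
  chord≈0⇒≈P a≈0 b≈0 = sym (x-y≈0⇒x≈y a≈0) , sym (x-y≈0⇒x≈y b≈0)

  -- Equality in k is not decidable: the normalisation of L says which chord coordinate is invertible.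
  chord-direction : ∀ L {p q} → p ∈L L → q ∈L L → ¬ p ≈P q → dir L ∼ᴾ (q -ᴾ p)
  chord-direction L@(line t u _ (inj₂ u≈1)) {p} {q} p∈L q∈L p≉q =
    s , inverse-unit a a≉0 , u≈sa , t≈sb
    where
    a = proj₁ (q -ᴾ p)
    b = proj₂ (q -ᴾ p)
    b≈ta : b ≈ t * a
    b≈ta = sym (trans (x-y≈0⇒x≈y (∈L⇒cross≈0 L p∈L q∈L)) (trans (*-congʳ u≈1) (*-identityˡ b)))
    a≉0 : ¬ a ≈ 0#
    a≉0 a≈0 = p≉q (chord≈0⇒≈P a≈0 (trans b≈ta (trans (*-congˡ a≈0) (zeroʳ t))))
    s = proj₁ (inverse a a≉0)
    as≈1 : a * s ≈ 1#
    as≈1 = proj₂ (inverse a a≉0)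
    u≈sa : u ≈ s * a
    u≈sa = trans u≈1 (trans (sym as≈1) (*-comm a s))
    t≈sb : t ≈ s * b
    t≈sb = begin
      t              ≈⟨ *-identityʳ t ⟨
      t * 1#         ≈⟨ *-congˡ as≈1 ⟨
      t * (a * s)    ≈⟨ solve 3 (λ t a s → t :* (a :* s) := s :* (t :* a)) refl t a s ⟩
      s * (t * a)    ≈⟨ *-congˡ b≈ta ⟨
      s * b          ∎
  chord-direction L@(line t u _ (inj₁ (u≈0 , t≈1))) {p} {q} p∈L q∈L p≉q =
    s , inverse-unit b b≉0 , u≈sa , t≈sb
    where
    a = proj₁ (q -ᴾ p)
    b = proj₂ (q -ᴾ p)
    a≈0 : a ≈ 0#
    a≈0 = begin
      a       ≈⟨ *-identityˡ a ⟨
      1# * a  ≈⟨ *-congʳ t≈1 ⟨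
      t * a   ≈⟨ x-y≈0⇒x≈y (∈L⇒cross≈0 L p∈L q∈L) ⟩
      u * b   ≈⟨ *-congʳ u≈0 ⟩
      0# * b  ≈⟨ zeroˡ b ⟩
      0#      ∎
    b≉0 : ¬ b ≈ 0#
    b≉0 b≈0 = p≉q (chord≈0⇒≈P a≈0 b≈0)
    s = proj₁ (inverse b b≉0)
    u≈sa : u ≈ s * a
    u≈sa = trans u≈0 (sym (trans (*-congˡ a≈0) (zeroʳ s)))
    t≈sb : t ≈ s * b
    t≈sb = trans t≈1 (trans (sym (proj₂ (inverse b b≉0))) (*-comm b s))

  ∈L-through-two-points : ∀ L M {p q r} → p ∈L L → q ∈L L → p ∈L M → q ∈L M → ¬ p ≈P q →
                          r ∈L L → r ∈L M
  ∈L-through-two-points L M {p} {r = r} p∈L q∈L p∈M q∈M p≉q r∈L =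
    cross≈0⇒∈L M p∈M
      (∼ᴾ-cross≈0⁻¹ (r -ᴾ p) (chord-direction M p∈M q∈M p≉q)
        (∼ᴾ-cross≈0 (r -ᴾ p) (chord-direction L p∈L q∈L p≉q) (∈L⇒cross≈0 L p∈L r∈L)))

  meet : ∀ L M → ¬ Parallel L M → Σ Point λ P → IsMeet P L M
  meet (line tL uL vL _) (line tM uM vM _) L∦M = (x , y) , on-L , on-M
    where
    D = tL * uM - uL * tM
    D≉0 : ¬ D ≈ 0#
    D≉0 D≈0 = L∦M (x-y≈0⇒x≈y D≈0)
    r = proj₁ (inverse D D≉0)
    x = r * (uL * vM - vL * uM)
    y = r * (tL * vM - vL * tM)
    w-wDr≈0 : ∀ w → w - w * (D * r) ≈ 0#
    w-wDr≈0 w = trans (+-congˡ (-‿cong (trans (*-congˡ (proj₂ (inverse D D≉0))) (*-identityʳ w)))) (-‿inverseʳ w)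
    on-L : tL * x - uL * y + vL ≈ 0#
    on-L = trans (solve 7 (λ tL uL vL tM uM vM r →
        tL :* (r :* (uL :* vM :- vL :* uM)) :- uL :* (r :* (tL :* vM :- vL :* tM)) :+ vL
          := vL :- vL :* ((tL :* uM :- uL :* tM) :* r))
      refl tL uL vL tM uM vM r) (w-wDr≈0 vL)
    on-M : tM * x - uM * y + vM ≈ 0#
    on-M = trans (solve 7 (λ tL uL vL tM uM vM r →
        tM :* (r :* (uL :* vM :- vL :* uM)) :- uM :* (r :* (tL :* vM :- vL :* tM)) :+ vM
          := vM :- vM :* ((tL :* uM :- uL :* tM) :* r))
      refl tL uL vL tM uM vM r) (w-wDr≈0 vM)

  Vec₃ : Set c
  Vec₃ = Carrier × Carrier × Carrier

  infix 4 _≈₃_ _∼₃_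
  infixl 6 _+₃_
  infixr 7 _·₃_
  infixl 7 _⊙_

  _≈₃_ : Vec₃ → Vec₃ → Set ℓ
  (x₁ , x₂ , x₃) ≈₃ (y₁ , y₂ , y₃) = (x₁ ≈ y₁) × (x₂ ≈ y₂) × (x₃ ≈ y₃)

  ≈₃-trans : ∀ {X Y Z} → X ≈₃ Y → Y ≈₃ Z → X ≈₃ Z
  ≈₃-trans (e₁ , e₂ , e₃) (f₁ , f₂ , f₃) = trans e₁ f₁ , trans e₂ f₂ , trans e₃ f₃

  _+₃_ : Vec₃ → Vec₃ → Vec₃
  (x₁ , x₂ , x₃) +₃ (y₁ , y₂ , y₃) = x₁ + y₁ , x₂ + y₂ , x₃ + y₃

  _·₃_ : Carrier → Vec₃ → Vec₃
  s ·₃ (x₁ , x₂ , x₃) = s * x₁ , s * x₂ , s * x₃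

  _∼₃_ : Vec₃ → Vec₃ → Set (c ⊔ ℓ)
  X ∼₃ Y = ∃ λ s → Unit s × X ≈₃ (s ·₃ Y)

  ∼₃-respʳ : ∀ {X Y Z} → X ∼₃ Y → Y ≈₃ Z → X ∼₃ Z
  ∼₃-respʳ (s , unit , (e₁ , e₂ , e₃)) (f₁ , f₂ , f₃) =
    s , unit , (trans e₁ (*-congˡ f₁) , trans e₂ (*-congˡ f₂) , trans e₃ (*-congˡ f₃))

  _⊙_ : Point → Point → Vec₃
  (x₁ , x₂) ⊙ (y₁ , y₂) = x₁ * y₁ , x₁ * y₂ + x₂ * y₁ , x₂ * y₂

  ⊙-comm : ∀ v w → v ⊙ w ≈₃ w ⊙ v
  ⊙-comm (x₁ , x₂) (y₁ , y₂) = *-comm x₁ y₁ , trans (+-comm _ _) (+-cong (*-comm x₂ y₁) (*-comm x₁ y₂)) , *-comm x₂ y₂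

  ⊙-cong : ∀ {v v' w w'} → v ≈P v' → w ≈P w' → v ⊙ w ≈₃ v' ⊙ w'
  ⊙-cong (e₁ , e₂) (f₁ , f₂) = *-cong e₁ f₁ , +-cong (*-cong e₁ f₂) (*-cong e₂ f₁) , *-cong e₂ f₂

  ⊙-scale : ∀ s s' v w → (s ·ᴾ v) ⊙ (s' ·ᴾ w) ≈₃ (s * s') ·₃ (v ⊙ w)
  ⊙-scale s s' (x₁ , x₂) (y₁ , y₂) =
    solve 4 (λ s s' x y → (s :* x) :* (s' :* y) := (s :* s') :* (x :* y)) refl s s' x₁ y₁ ,
    solve 6 (λ s s' x₁ x₂ y₁ y₂ → (s :* x₁) :* (s' :* y₂) :+ (s :* x₂) :* (s' :* y₁)
                                    := (s :* s') :* (x₁ :* y₂ :+ x₂ :* y₁)) refl s s' x₁ x₂ y₁ y₂ ,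
    solve 4 (λ s s' x y → (s :* x) :* (s' :* y) := (s :* s') :* (x :* y)) refl s s' x₂ y₂

  ⊙-∼ : ∀ {v v' w w'} → v ∼ᴾ v' → w ∼ᴾ w' → v ⊙ w ∼₃ v' ⊙ w'
  ⊙-∼ {v' = v'} {w' = w'} (s , unit , v≈sv') (s' , unit' , w≈s'w') =
    s * s' , Unit-* unit unit' , ≈₃-trans (⊙-cong v≈sv' w≈s'w') (⊙-scale s s' v' w')

  ⊙-diagonals : ∀ p₁ p₂ p₃ p₄ →
    (p₃ -ᴾ p₁) ⊙ (p₄ -ᴾ p₂) ≈₃ (p₄ -ᴾ p₁) ⊙ (p₃ -ᴾ p₂) +₃ (p₂ -ᴾ p₁) ⊙ (p₄ -ᴾ p₃)
  ⊙-diagonals (x₁ , y₁) (x₂ , y₂) (x₃ , y₃) (x₄ , y₄) =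
    solve 4 (λ x₁ x₂ x₃ x₄ →
        (x₃ :- x₁) :* (x₄ :- x₂) := (x₄ :- x₁) :* (x₃ :- x₂) :+ (x₂ :- x₁) :* (x₄ :- x₃))
      refl x₁ x₂ x₃ x₄ ,
    solve 8 (λ x₁ y₁ x₂ y₂ x₃ y₃ x₄ y₄ →
        (x₃ :- x₁) :* (y₄ :- y₂) :+ (y₃ :- y₁) :* (x₄ :- x₂)
          := ((x₄ :- x₁) :* (y₃ :- y₂) :+ (y₄ :- y₁) :* (x₃ :- x₂))
             :+ ((x₂ :- x₁) :* (y₄ :- y₃) :+ (y₂ :- y₁) :* (x₄ :- x₃)))
      refl x₁ y₁ x₂ y₂ x₃ y₃ x₄ y₄ ,
    solve 4 (λ y₁ y₂ y₃ y₄ →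
        (y₃ :- y₁) :* (y₄ :- y₂) := (y₄ :- y₁) :* (y₃ :- y₂) :+ (y₂ :- y₁) :* (y₄ :- y₃))
      refl y₁ y₂ y₃ y₄

  InSpan : Vec₃ → Vec₃ → Vec₃ → Set (c ⊔ ℓ)
  InSpan X U V = ∃ λ a → ∃ λ b → X ≈₃ a ·₃ U +₃ b ·₃ V

  InSpan-respˡ : ∀ {X Y U V} → X ≈₃ Y → InSpan Y U V → InSpan X U V
  InSpan-respˡ X≈Y (a , b , Y≈aU+bV) = a , b , ≈₃-trans X≈Y Y≈aU+bV

  ∼₃⇒InSpanˡ : ∀ {X U V} → X ∼₃ U → InSpan X U V
  ∼₃⇒InSpanˡ (s , _ , (e₁ , e₂ , e₃)) = s , 0# , (trans e₁ x≈x+0y , trans e₂ x≈x+0y , trans e₃ x≈x+0y)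
    where
    x≈x+0y : ∀ {x y} → x ≈ x + 0# * y
    x≈x+0y {x} {y} = sym (trans (+-congˡ (zeroˡ y)) (+-identityʳ x))

  ∼₃⇒InSpanʳ : ∀ {X U V} → X ∼₃ V → InSpan X U V
  ∼₃⇒InSpanʳ (s , _ , (e₁ , e₂ , e₃)) = 0# , s , (trans e₁ y≈0x+y , trans e₂ y≈0x+y , trans e₃ y≈0x+y)
    where
    y≈0x+y : ∀ {x y} → y ≈ 0# * x + y
    y≈0x+y {x} {y} = sym (trans (+-congʳ (zeroˡ x)) (+-identityˡ y))

  ∼₃⇒InSpan-+ : ∀ {X U V} → X ∼₃ U +₃ V → InSpan X U V
  ∼₃⇒InSpan-+ (s , _ , (e₁ , e₂ , e₃)) =
    s , s , (trans e₁ (distribˡ s _ _) , trans e₂ (distribˡ s _ _) , trans e₃ (distribˡ s _ _))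

  InSpan-rebase : ∀ {X U V U' V'} → InSpan X U V → U' ∼₃ U → V' ∼₃ V → InSpan X U' V'
  InSpan-rebase (a , b , (e₁ , e₂ , e₃)) (s , (r , rs≈1) , (f₁ , f₂ , f₃)) (s' , (r' , r's'≈1) , (g₁ , g₂ , g₃)) =
    a * r , b * r' ,
    (trans e₁ (rebase f₁ g₁) , trans e₂ (rebase f₂ g₂) , trans e₃ (rebase f₃ g₃))
    where
    rebase : ∀ {x y x' y'} → x' ≈ s * x → y' ≈ s' * y → a * x + b * y ≈ (a * r) * x' + (b * r') * y'
    rebase x'≈sx y'≈s'y = +-cong (unit-rescale a rs≈1 x'≈sx) (unit-rescale b r's'≈1 y'≈s'y)

  det₃ : Vec₃ → Vec₃ → Vec₃ → Carrier
  det₃ (x₁ , x₂ , x₃) (y₁ , y₂ , y₃) (z₁ , z₂ , z₃) =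
    x₁ * (y₂ * z₃ - y₃ * z₂) - x₂ * (y₁ * z₃ - y₃ * z₁) + x₃ * (y₁ * z₂ - y₂ * z₁)

  det₃-congʳ : ∀ X {U U' V V'} → U ≈₃ U' → V ≈₃ V' → det₃ X U V ≈ det₃ X U' V'
  det₃-congʳ X (e₁ , e₂ , e₃) (f₁ , f₂ , f₃) =
    +-cong (+-cong (*-congˡ (minus (*-cong e₂ f₃) (*-cong e₃ f₂)))
                   (-‿cong (*-congˡ (minus (*-cong e₁ f₃) (*-cong e₃ f₁)))))
           (*-congˡ (minus (*-cong e₁ f₂) (*-cong e₂ f₁)))
    where
    minus : ∀ {a a' b b'} → a ≈ a' → b ≈ b' → a - b ≈ a' - b'
    minus a≈a' b≈b' = +-cong a≈a' (-‿cong b≈b')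

  det₃-combination : ∀ X U V a b c d →
    det₃ X (a ·₃ U +₃ b ·₃ V) (c ·₃ U +₃ d ·₃ V) ≈ (a * d - b * c) * det₃ X U V
  det₃-combination (x₁ , x₂ , x₃) (y₁ , y₂ , y₃) (z₁ , z₂ , z₃) a b c d =
    solve 13 (λ x₁ x₂ x₃ y₁ y₂ y₃ z₁ z₂ z₃ a b c d →
        x₁ :* ((a :* y₂ :+ b :* z₂) :* (c :* y₃ :+ d :* z₃) :- (a :* y₃ :+ b :* z₃) :* (c :* y₂ :+ d :* z₂))
        :- x₂ :* ((a :* y₁ :+ b :* z₁) :* (c :* y₃ :+ d :* z₃) :- (a :* y₃ :+ b :* z₃) :* (c :* y₁ :+ d :* z₁))
        :+ x₃ :* ((a :* y₁ :+ b :* z₁) :* (c :* y₂ :+ d :* z₂) :- (a :* y₂ :+ b :* z₂) :* (c :* y₁ :+ d :* z₁))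
        := (a :* d :- b :* c) :* (x₁ :* (y₂ :* z₃ :- y₃ :* z₂) :- x₂ :* (y₁ :* z₃ :- y₃ :* z₁) :+ x₃ :* (y₁ :* z₂ :- y₂ :* z₁)))
      refl x₁ x₂ x₃ y₁ y₂ y₃ z₁ z₂ z₃ a b c d

  opposite₁ opposite₂ : Quadrilateral → Vec₃
  opposite₁ Q = dir (A Q) ⊙ dir (A' Q)
  opposite₂ Q = dir (B Q) ⊙ dir (B' Q)

  ⟨⟩≈-det₃ : ∀ Q v w → ⟨ v , w ⟩[ Q ] ≈ - det₃ (v ⊙ w) (opposite₁ Q) (opposite₂ Q)
  ⟨⟩≈-det₃ Q (p₁ , p₂) (q₁ , q₂) = solve 12 (λ tA uA tB uB tA' uA' tB' uB' p₁ p₂ q₁ q₂ →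
      p₁ :* ((tA :* tB :* tA' :* uB' :- tA :* tB :* uA' :* tB' :+ tA :* uB :* tA' :* tB' :- uA :* tB :* tA' :* tB') :* q₁
             :- (tA :* uB :* tA' :* uB' :- uA :* tB :* uA' :* tB') :* q₂)
      :+ p₂ :* (:- (tA :* uB :* tA' :* uB' :- uA :* tB :* uA' :* tB') :* q₁
             :+ (tA :* uB :* uA' :* uB' :- uA :* tB :* uA' :* uB' :+ uA :* uB :* tA' :* uB' :- uA :* uB :* uA' :* tB') :* q₂)
      := :- ((p₁ :* q₁) :* ((uA :* tA' :+ tA :* uA') :* (tB :* tB') :- (tA :* tA') :* (uB :* tB' :+ tB :* uB'))
             :- (p₁ :* q₂ :+ p₂ :* q₁) :* ((uA :* uA') :* (tB :* tB') :- (tA :* tA') :* (uB :* uB'))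
             :+ (p₂ :* q₂) :* ((uA :* uA') :* (uB :* tB' :+ tB :* uB') :- (uA :* tA' :+ tA :* uA') :* (uB :* uB'))))
    refl (t (A Q)) (u (A Q)) (t (B Q)) (u (B Q)) (t (A' Q)) (u (A' Q)) (t (B' Q)) (u (B' Q)) p₁ p₂ q₁ q₂

  OnEither : Line → Line → Point → Set ℓ
  OnEither L L' P = P ∈L L ⊎ P ∈L L'

  OnEither-resp-≈P : ∀ L L' {p q} → p ≈P q → OnEither L L' q → OnEither L L' p
  OnEither-resp-≈P L L' p≈q (inj₁ q∈L) = inj₁ (∈L-resp-≈P L p≈q q∈L)
  OnEither-resp-≈P L L' p≈q (inj₂ q∈L') = inj₂ (∈L-resp-≈P L' p≈q q∈L')

  vertex-on-A∪A' : ∀ Q {P} → IsVertex Q P → OnEither (A Q) (A' Q) P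
  vertex-on-A∪A' Q (inj₁ (P∈A , _)) = inj₁ P∈A
  vertex-on-A∪A' Q (inj₂ (inj₁ (_ , P∈A'))) = inj₂ P∈A'
  vertex-on-A∪A' Q (inj₂ (inj₂ (inj₁ (P∈A' , _)))) = inj₂ P∈A'
  vertex-on-A∪A' Q (inj₂ (inj₂ (inj₂ (_ , P∈A)))) = inj₁ P∈A

  vertex-on-B∪B' : ∀ Q {P} → IsVertex Q P → OnEither (B Q) (B' Q) P
  vertex-on-B∪B' Q (inj₁ (_ , P∈B)) = inj₁ P∈B
  vertex-on-B∪B' Q (inj₂ (inj₁ (P∈B , _))) = inj₁ P∈B
  vertex-on-B∪B' Q (inj₂ (inj₂ (inj₁ (_ , P∈B')))) = inj₂ P∈B'
  vertex-on-B∪B' Q (inj₂ (inj₂ (inj₂ (P∈B' , _)))) = inj₂ P∈B'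

  IsMeet-apart : ∀ L M L' M' {p q} → (∀ P → ¬ (IsMeet P L M × IsMeet P L' M')) →
                 IsMeet p L M → IsMeet q L' M' → ¬ p ≈P q
  IsMeet-apart L M L' M' disjoint p∈L∩M q∈L'∩M' p≈q =
    disjoint _ (p∈L∩M , IsMeet-resp-≈P L' M' p≈q q∈L'∩M')

  chords-⊙ : ∀ L L' {p q r s} → p ∈L L → q ∈L L → ¬ p ≈P q → r ∈L L' → s ∈L L' → ¬ r ≈P s →
             dir L ⊙ dir L' ∼₃ (q -ᴾ p) ⊙ (s -ᴾ r)
  chords-⊙ L L' p∈L q∈L p≉q r∈L' s∈L' r≉s =
    ⊙-∼ (chord-direction L p∈L q∈L p≉q) (chord-direction L' r∈L' s∈L' r≉s)

  InSpan-swap : ∀ L L' {U V} → InSpan (dir L' ⊙ dir L) U V → InSpan (dir L ⊙ dir L') U V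
  InSpan-swap L L' = InSpan-respˡ (⊙-comm (dir L) (dir L'))

  module FourVertices (Q : Quadrilateral) {p₁ p₂ p₃ p₄ : Point}
      (v₁ : V₁ Q p₁) (v₂ : V₂ Q p₂) (v₃ : V₃ Q p₃) (v₄ : V₄ Q p₄)
      (V₁V₂ : ∀ P → ¬ (V₁ Q P × V₂ Q P)) (V₁V₃ : ∀ P → ¬ (V₁ Q P × V₃ Q P))
      (V₁V₄ : ∀ P → ¬ (V₁ Q P × V₄ Q P)) (V₂V₃ : ∀ P → ¬ (V₂ Q P × V₃ Q P))
      (V₂V₄ : ∀ P → ¬ (V₂ Q P × V₄ Q P)) (V₃V₄ : ∀ P → ¬ (V₃ Q P × V₄ Q P)) where

    p₁≉p₂ : ¬ p₁ ≈P p₂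
    p₁≉p₂ = IsMeet-apart (A Q) (B Q) (B Q) (A' Q) V₁V₂ v₁ v₂
    p₁≉p₃ : ¬ p₁ ≈P p₃
    p₁≉p₃ = IsMeet-apart (A Q) (B Q) (A' Q) (B' Q) V₁V₃ v₁ v₃
    p₁≉p₄ : ¬ p₁ ≈P p₄
    p₁≉p₄ = IsMeet-apart (A Q) (B Q) (B' Q) (A Q) V₁V₄ v₁ v₄
    p₂≉p₃ : ¬ p₂ ≈P p₃
    p₂≉p₃ = IsMeet-apart (B Q) (A' Q) (A' Q) (B' Q) V₂V₃ v₂ v₃
    p₂≉p₄ : ¬ p₂ ≈P p₄
    p₂≉p₄ = IsMeet-apart (B Q) (A' Q) (B' Q) (A Q) V₂V₄ v₂ v₄
    p₃≉p₄ : ¬ p₃ ≈P p₄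
    p₃≉p₄ = IsMeet-apart (A' Q) (B' Q) (B' Q) (A Q) V₃V₄ v₃ v₄

    ¬collinear₁₂₃ : ∀ M → p₁ ∈L M → p₂ ∈L M → p₃ ∈L M → ⊥
    ¬collinear₁₂₃ M p₁∈M p₂∈M p₃∈M =
      V₂V₃ p₃ ((∈L-through-two-points M (B Q) p₁∈M p₂∈M (proj₂ v₁) (proj₁ v₂) p₁≉p₂ p₃∈M , proj₁ v₃) , v₃)

    ¬collinear₁₂₄ : ∀ M → p₁ ∈L M → p₂ ∈L M → p₄ ∈L M → ⊥
    ¬collinear₁₂₄ M p₁∈M p₂∈M p₄∈M =
      V₁V₄ p₄ ((proj₂ v₄ , ∈L-through-two-points M (B Q) p₁∈M p₂∈M (proj₂ v₁) (proj₁ v₂) p₁≉p₂ p₄∈M) , v₄)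

    ¬collinear₁₃₄ : ∀ M → p₁ ∈L M → p₃ ∈L M → p₄ ∈L M → ⊥
    ¬collinear₁₃₄ M p₁∈M p₃∈M p₄∈M =
      V₃V₄ p₃ (v₃ , (proj₂ v₃ , ∈L-through-two-points M (A Q) p₁∈M p₄∈M (proj₁ v₁) (proj₂ v₄) p₁≉p₄ p₃∈M))

    ¬collinear₂₃₄ : ∀ M → p₂ ∈L M → p₃ ∈L M → p₄ ∈L M → ⊥
    ¬collinear₂₃₄ M p₂∈M p₃∈M p₄∈M =
      V₃V₄ p₄ ((∈L-through-two-points M (A' Q) p₂∈M p₃∈M (proj₂ v₂) (proj₁ v₃) p₂≉p₃ p₄∈M , proj₁ v₄) , v₄)

    W₁ W₂ : Vec₃
    W₁ = (p₄ -ᴾ p₁) ⊙ (p₃ -ᴾ p₂)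
    W₂ = (p₂ -ᴾ p₁) ⊙ (p₄ -ᴾ p₃)

    span-of-cover : ∀ L L' → OnEither L L' p₁ → OnEither L L' p₂ → OnEither L L' p₃ → OnEither L L' p₄ →
                    InSpan (dir L ⊙ dir L') W₁ W₂
    span-of-cover L L' (inj₁ p₁∈L) (inj₁ p₂∈L) (inj₁ p₃∈L) _ = ⊥-elim (¬collinear₁₂₃ L p₁∈L p₂∈L p₃∈L)
    span-of-cover L L' (inj₁ p₁∈L) (inj₁ p₂∈L) (inj₂ _) (inj₁ p₄∈L) = ⊥-elim (¬collinear₁₂₄ L p₁∈L p₂∈L p₄∈L)
    span-of-cover L L' (inj₁ p₁∈L) (inj₁ p₂∈L) (inj₂ p₃∈L') (inj₂ p₄∈L') =
      ∼₃⇒InSpanʳ (chords-⊙ L L' p₁∈L p₂∈L p₁≉p₂ p₃∈L' p₄∈L' p₃≉p₄)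
    span-of-cover L L' (inj₁ p₁∈L) (inj₂ _) (inj₁ p₃∈L) (inj₁ p₄∈L) = ⊥-elim (¬collinear₁₃₄ L p₁∈L p₃∈L p₄∈L)
    span-of-cover L L' (inj₁ p₁∈L) (inj₂ p₂∈L') (inj₁ p₃∈L) (inj₂ p₄∈L') =
      ∼₃⇒InSpan-+ (∼₃-respʳ (chords-⊙ L L' p₁∈L p₃∈L p₁≉p₃ p₂∈L' p₄∈L' p₂≉p₄) (⊙-diagonals p₁ p₂ p₃ p₄))
    span-of-cover L L' (inj₁ p₁∈L) (inj₂ p₂∈L') (inj₂ p₃∈L') (inj₁ p₄∈L) =
      ∼₃⇒InSpanˡ (chords-⊙ L L' p₁∈L p₄∈L p₁≉p₄ p₂∈L' p₃∈L' p₂≉p₃)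
    span-of-cover L L' (inj₁ _) (inj₂ p₂∈L') (inj₂ p₃∈L') (inj₂ p₄∈L') = ⊥-elim (¬collinear₂₃₄ L' p₂∈L' p₃∈L' p₄∈L')
    span-of-cover L L' (inj₂ _) (inj₁ p₂∈L) (inj₁ p₃∈L) (inj₁ p₄∈L) = ⊥-elim (¬collinear₂₃₄ L p₂∈L p₃∈L p₄∈L)
    span-of-cover L L' (inj₂ p₁∈L') (inj₁ p₂∈L) (inj₁ p₃∈L) (inj₂ p₄∈L') =
      InSpan-swap L L' (span-of-cover L' L (inj₁ p₁∈L') (inj₂ p₂∈L) (inj₂ p₃∈L) (inj₁ p₄∈L'))
    span-of-cover L L' (inj₂ p₁∈L') (inj₁ p₂∈L) (inj₂ p₃∈L') (inj₁ p₄∈L) =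
      InSpan-swap L L' (span-of-cover L' L (inj₁ p₁∈L') (inj₂ p₂∈L) (inj₁ p₃∈L') (inj₂ p₄∈L))
    span-of-cover L L' (inj₂ p₁∈L') (inj₁ _) (inj₂ p₃∈L') (inj₂ p₄∈L') = ⊥-elim (¬collinear₁₃₄ L' p₁∈L' p₃∈L' p₄∈L')
    span-of-cover L L' (inj₂ p₁∈L') (inj₂ p₂∈L') (inj₁ p₃∈L) (inj₁ p₄∈L) =
      InSpan-swap L L' (span-of-cover L' L (inj₁ p₁∈L') (inj₁ p₂∈L') (inj₂ p₃∈L) (inj₂ p₄∈L))
    span-of-cover L L' (inj₂ p₁∈L') (inj₂ p₂∈L') (inj₁ _) (inj₂ p₄∈L') = ⊥-elim (¬collinear₁₂₄ L' p₁∈L' p₂∈L' p₄∈L')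
    span-of-cover L L' (inj₂ p₁∈L') (inj₂ p₂∈L') (inj₂ p₃∈L') _ = ⊥-elim (¬collinear₁₂₃ L' p₁∈L' p₂∈L' p₃∈L')

    opposite₁∼W₁ : opposite₁ Q ∼₃ W₁
    opposite₁∼W₁ = chords-⊙ (A Q) (A' Q) (proj₁ v₁) (proj₂ v₄) p₁≉p₄ (proj₂ v₂) (proj₁ v₃) p₂≉p₃

    opposite₂∼W₂ : opposite₂ Q ∼₃ W₂
    opposite₂∼W₂ = chords-⊙ (B Q) (B' Q) (proj₂ v₁) (proj₁ v₂) p₁≉p₂ (proj₂ v₃) (proj₁ v₄) p₃≉p₄

  vertex-cover⇒InSpan : ∀ Q → IsProper Q → ∀ L L' → (∀ P → IsVertex Q P → OnEither L L' P) →
                        InSpan (dir L ⊙ dir L') (opposite₁ Q) (opposite₂ Q)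
  vertex-cover⇒InSpan Q ((_ , _ , _ , _ , _ , _ , _ , A∦B , B∦A' , A'∦B' , B'∦A) , V₁V₂ , V₁V₃ , V₁V₄ , V₂V₃ , V₂V₄ , V₃V₄)
                      L L' cover =
    InSpan-rebase
      (span-of-cover L L' (cover _ (inj₁ v₁)) (cover _ (inj₂ (inj₁ v₂)))
                          (cover _ (inj₂ (inj₂ (inj₁ v₃)))) (cover _ (inj₂ (inj₂ (inj₂ v₄)))))
      opposite₁∼W₁ opposite₂∼W₂
    where
    v₁ = proj₂ (meet (A Q) (B Q) A∦B)
    v₂ = proj₂ (meet (B Q) (A' Q) B∦A')
    v₃ = proj₂ (meet (A' Q) (B' Q) A'∦B')
    v₄ = proj₂ (meet (B' Q) (A Q) B'∦A)
    open FourVertices Q v₁ v₂ v₃ v₄ V₁V₂ V₁V₃ V₁V₄ V₂V₃ V₂V₄ V₃V₄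

  Proportional : Quadrilateral → Quadrilateral → Set (c ⊔ ℓ)
  Proportional Q Q' = ∃ λ μ → ∀ v w → ⟨ v , w ⟩[ Q' ] ≈ μ * ⟨ v , w ⟩[ Q ]

  InSpan⇒Proportional : ∀ Q Q' → InSpan (opposite₁ Q') (opposite₁ Q) (opposite₂ Q) →
                        InSpan (opposite₂ Q') (opposite₁ Q) (opposite₂ Q) → Proportional Q Q'
  InSpan⇒Proportional Q Q' (a , b , e₁) (c , d , e₂) = a * d - b * c , λ v w → begin
    ⟨ v , w ⟩[ Q' ]                                       ≈⟨ ⟨⟩≈-det₃ Q' v w ⟩
    - det₃ (v ⊙ w) (opposite₁ Q') (opposite₂ Q')          ≈⟨ -‿cong (det₃-congʳ (v ⊙ w) e₁ e₂) ⟩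
    - det₃ (v ⊙ w) (a ·₃ U +₃ b ·₃ V) (c ·₃ U +₃ d ·₃ V)  ≈⟨ -‿cong (det₃-combination (v ⊙ w) U V a b c d) ⟩
    - ((a * d - b * c) * det₃ (v ⊙ w) U V)                ≈⟨ -‿distribʳ-* (a * d - b * c) _ ⟩
    (a * d - b * c) * - det₃ (v ⊙ w) U V                  ≈⟨ *-congˡ (⟨⟩≈-det₃ Q v w) ⟨
    (a * d - b * c) * ⟨ v , w ⟩[ Q ]                      ∎
    where
    U = opposite₁ Q
    V = opposite₂ Q

  ⟨⟩-proportional : ∀ Q Q' → IsProper Q →
                    (∀ P → IsVertex Q P → Σ Point λ P' → P ≈P P' × IsVertex Q' P') → Proportional Q Q'
  ⟨⟩-proportional Q Q' proper vertices⊆ =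
    InSpan⇒Proportional Q Q'
      (vertex-cover⇒InSpan Q proper (A Q') (A' Q') (cover (A Q') (A' Q') (vertex-on-A∪A' Q')))
      (vertex-cover⇒InSpan Q proper (B Q') (B' Q') (cover (B Q') (B' Q') (vertex-on-B∪B' Q')))
    where
    cover : ∀ L L' → (∀ {P} → IsVertex Q' P → OnEither L L' P) → ∀ P → IsVertex Q P → OnEither L L' P
    cover L L' on-sides P P∈Q with vertices⊆ P P∈Q
    ... | _ , P≈P' , P'∈Q' = OnEither-resp-≈P L L' P≈P' (on-sides P'∈Q')

  Proportional⇒Orthogonal : ∀ Q Q' → Proportional Q Q' → ∀ ℓ₁ ℓ₂ → Orthogonal Q ℓ₁ ℓ₂ → Orthogonal Q' ℓ₁ ℓ₂
  Proportional⇒Orthogonal Q Q' (μ , ⟨⟩Q'≈μ⟨⟩Q) ℓ₁ ℓ₂ orthogonal =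
    trans (⟨⟩Q'≈μ⟨⟩Q _ _) (trans (*-congˡ orthogonal) (zeroʳ μ))

corollary2p7 : ∀ {c ℓ} (k : Field c ℓ) → CharNot2 k →
    let open Geometry k in
    (Q Q' : Quadrilateral) → IsProper Q → IsProper Q' → SameVertices Q Q' →
    (ℓ₁ ℓ₂ : Line) →
    (Orthogonal Q ℓ₁ ℓ₂ → Orthogonal Q' ℓ₁ ℓ₂) × (Orthogonal Q' ℓ₁ ℓ₂ → Orthogonal Q ℓ₁ ℓ₂)
corollary2p7 k _ Q Q' proper proper' (Q⊆Q' , Q'⊆Q) ℓ₁ ℓ₂ =
  Proportional⇒Orthogonal Q Q' (⟨⟩-proportional Q Q' proper Q⊆Q') ℓ₁ ℓ₂ ,
  Proportional⇒Orthogonal Q' Q (⟨⟩-proportional Q' Q proper' Q'⊆Q) ℓ₁ ℓ₂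
  where open Plane k
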